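{- Let $U$ be a set and $S,P,M\subseteq U$. Suppose two distinct PCPs, each of type (1) $E(M^*,P^*)E(M^{*\prime},S^*)$ or of type (2) $E(M^*,P^*)E(M^*,S^*)$ (with $M^*\in\{M,M'\}$, $P^*\in\{P,P'\}$, $S^*\in\{S,S'\}$), have all four of their premises true. Then at least one of the following holds: $M=\emptyset$, $M'=\emptyset$, $P=\emptyset$, $P'=\emptyset$, $S=\emptyset$, $S'=\emptyset$, $P=M$, $P=M'$, $S=M$, $S=M'$.
   Context: $X'=U\setminus X$. $E(X,Y)$ means $X\cap Y=\emptyset$. A PCP is an ordered pair (P-premise, S-premise); two PCPs are distinct if they differ in the P-premise or in the S-premise (as formal statements). $M^{*\prime}$ denotes the complement of $M^*$. -}

module Defs where

open import Data.Bool using (Bool; true; false; not; _∧_)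
open import Data.Product using (_×_; _,_)
open import Relation.Binary.PropositionalEquality using (_≡_)
open import Relation.Nullary using (¬_)

Subset : Set → Set
Subset U = U → Bool

_′ : {U : Set} → Subset U → Subset U
(X ′) x = not (X x)

∅ : {U : Set} → Subset U
∅ x = false

_≐_ : {U : Set} → Subset U → Subset U → Set
X ≐ Y = ∀ x → X x ≡ Y x

E : {U : Set} → Subset U → Subset U → Set
E X Y = ∀ x → X x ∧ Y x ≡ false

-- X* ∈ {X, X'} : the flag says whether the complement is taken
star : {U : Set} → Bool → Subset U → Subset U
star false X = X
star true  X = X ′

data PCPType : Set where
  type1 type2 : PCPType   -- (1) E(M*,P*)E(M*',S*)   (2) E(M*,P*)E(M*,S*)

record PCP : Set where
  constructor pcp
  field
    ty : PCPType
    m  : Bool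
    p  : Bool
    s  : Bool
open PCP public

-- A formal premise E(A*,B*) with A ∈ {M}, B ∈ {P,S}; recorded by the
-- two complement flags (the middle term M^{*'} of a type (1) PCP
-- is the complement of M*, i.e. M or M' accordingly).
Premise : Set
Premise = Bool × Bool

Ppremise : PCP → Premise
Ppremise c = m c , p c

sMflag : PCP → Bool
sMflag (pcp type1 m _ _) = not m
sMflag (pcp type2 m _ _) = m

Spremise : PCP → Premise
Spremise c = sMflag c , s c

Distinct : PCP → PCP → Set
Distinct c d = ¬ (Ppremise c ≡ Ppremise d × Spremise c ≡ Spremise d)

PTrue : {U : Set} → (S P M : Subset U) → PCP → Set
PTrue S P M c = E (star (m c) M) (star (p c) P)

STrue : {U : Set} → (S P M : Subset U) → PCP → Set
STrue S P M c = E (star (sMflag c) M) (star (s c) S)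

module Submission where

-- Two premises E(M*,X*) and E(M*₂,X*₂) about the same pair of sets M, X
-- (X = P or X = S) that are simultaneously true but formally different
-- force a degenerate configuration of M and X:
--   * same M-flag, different X-flag: M* misses both X* and X*', so M* = ∅;
--   * different M-flag, same X-flag: symmetrically X* = ∅;
--   * both flags different: M* ∩ X* = ∅ and M*' ∩ X*' = ∅, so X* = M*'.
-- Undoing the flags, these say M or M' is empty, X or X' is empty, or
-- X ∈ {M, M'}.  Two distinct PCPs differ in their P-premises or in their
-- S-premises, so applying this to that pair of premises yields the theorem,
-- even constructively.

open import Defs
open import Data.Bool using (Bool; true; false; not; _∧_)
open import Data.Bool.Properties using (_≟_; ∧-comm; not-involutive; not-injective)
open import Data.Empty using (⊥-elim)
open import Data.Product using (_,_)
open import Data.Sum using (_⊎_; inj₁; inj₂)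
open import Function using (_∘_)
open import Relation.Binary.PropositionalEquality
  using (_≡_; _≢_; refl; sym; trans; cong₂; subst)
open import Relation.Nullary using (¬_; yes; no)

disjoint-both⇒empty : {U : Set} (X Y : Subset U) → E X Y → E X (Y ′) → X ≐ ∅
disjoint-both⇒empty X Y e e′ x = pointwise (X x) (Y x) (e x) (e′ x)
  where
  pointwise : ∀ u v → u ∧ v ≡ false → u ∧ not v ≡ false → u ≡ false
  pointwise false _     _  _ = refl
  pointwise true  false _  ()
  pointwise true  true  () _

disjoint-complements⇒complement : {U : Set} (X Y : Subset U) →
  E X Y → E (X ′) (Y ′) → Y ≐ (X ′)
disjoint-complements⇒complement X Y e e′ x = pointwise (X x) (Y x) (e x) (e′ x)
  where
  pointwise : ∀ u v → u ∧ v ≡ false → not u ∧ not v ≡ false → v ≡ not u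
  pointwise false false _  ()
  pointwise false true  _  _ = refl
  pointwise true  false _  _ = refl
  pointwise true  true  () _

E-sym : {U : Set} (X Y : Subset U) → E X Y → E Y X
E-sym X Y e x = trans (∧-comm (Y x) (X x)) (e x)

E-resp-≐ : {U : Set} {X X₂ Y Y₂ : Subset U} →
  X ≐ X₂ → Y ≐ Y₂ → E X Y → E X₂ Y₂
E-resp-≐ X≐X₂ Y≐Y₂ e x =
  subst (λ w → w ≡ false) (cong₂ _∧_ (X≐X₂ x) (Y≐Y₂ x)) (e x)

star-flip : {U : Set} (X : Subset U) {b b₂ : Bool} →
  b ≢ b₂ → star b₂ X ≐ ((star b X) ′)
star-flip X {false} {false} b≢b₂ _ = ⊥-elim (b≢b₂ refl)
star-flip X {false} {true}  _    _ = refl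
star-flip X {true}  {false} _    x = sym (not-involutive (X x))
star-flip X {true}  {true}  b≢b₂ _ = ⊥-elim (b≢b₂ refl)

star-empty : {U : Set} (X : Subset U) (a : Bool) →
  star a X ≐ ∅ → X ≐ ∅ ⊎ (X ′) ≐ ∅
star-empty X false = inj₁
star-empty X true  = inj₂

star-complement : {U : Set} (X Y : Subset U) (a b : Bool) →
  star b Y ≐ ((star a X) ′) → Y ≐ X ⊎ Y ≐ (X ′)
star-complement X Y false false h = inj₂ h
star-complement X Y false true  h = inj₁ (not-injective ∘ h)
star-complement X Y true  false h = inj₁ (λ x → trans (h x) (not-involutive (X x)))
star-complement X Y true  true  h = inj₂ (not-injective ∘ h)

Degenerate : {U : Set} → Subset U → Subset U → Set
Degenerate X Y = (X ≐ ∅ ⊎ (X ′) ≐ ∅) ⊎ (Y ≐ ∅ ⊎ (Y ′) ≐ ∅) ⊎ (Y ≐ X ⊎ Y ≐ (X ′))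

true-premises-coincide-or-degenerate : {U : Set} (X Y : Subset U)
  (a b a₂ b₂ : Bool) →
  E (star a X) (star b Y) → E (star a₂ X) (star b₂ Y) →
  (a , b) ≡ (a₂ , b₂) ⊎ Degenerate X Y
true-premises-coincide-or-degenerate X Y a b a₂ b₂ e e₂
  with a ≟ a₂ | b ≟ b₂
... | yes refl | yes refl = inj₁ refl
... | yes refl | no b≢b₂ =
  inj₂ (inj₁ (star-empty X a (disjoint-both⇒empty (star a X) (star b Y) e
    (E-resp-≐ (λ _ → refl) (star-flip Y b≢b₂) e₂))))
... | no a≢a₂ | yes refl =
  inj₂ (inj₂ (inj₁ (star-empty Y b (disjoint-both⇒empty (star b Y) (star a X)
    (E-sym (star a X) (star b Y) e)
    (E-resp-≐ (λ _ → refl) (star-flip X a≢a₂)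
      (E-sym (star a₂ X) (star b Y) e₂))))))
... | no a≢a₂ | no b≢b₂ =
  inj₂ (inj₂ (inj₂ (star-complement X Y a b
    (disjoint-complements⇒complement (star a X) (star b Y) e
      (E-resp-≐ (star-flip X a≢a₂) (star-flip Y b≢b₂) e₂)))))

Conclusion : {U : Set} (S P M : Subset U) → Set
Conclusion S P M = M ≐ ∅ ⊎ (M ′) ≐ ∅ ⊎ P ≐ ∅ ⊎ (P ′) ≐ ∅ ⊎ S ≐ ∅ ⊎ (S ′) ≐ ∅
  ⊎ P ≐ M ⊎ P ≐ (M ′) ⊎ S ≐ M ⊎ S ≐ (M ′)

degenerate-MP⇒conclusion : {U : Set} (S P M : Subset U) →
  Degenerate M P → Conclusion S P M
degenerate-MP⇒conclusion S P M (inj₁ (inj₁ h)) = inj₁ h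
degenerate-MP⇒conclusion S P M (inj₁ (inj₂ h)) = inj₂ (inj₁ h)
degenerate-MP⇒conclusion S P M (inj₂ (inj₁ (inj₁ h))) = inj₂ (inj₂ (inj₁ h))
degenerate-MP⇒conclusion S P M (inj₂ (inj₁ (inj₂ h))) = inj₂ (inj₂ (inj₂ (inj₁ h)))
degenerate-MP⇒conclusion S P M (inj₂ (inj₂ (inj₁ h))) =
  inj₂ (inj₂ (inj₂ (inj₂ (inj₂ (inj₂ (inj₁ h))))))
degenerate-MP⇒conclusion S P M (inj₂ (inj₂ (inj₂ h))) =
  inj₂ (inj₂ (inj₂ (inj₂ (inj₂ (inj₂ (inj₂ (inj₁ h)))))))

degenerate-MS⇒conclusion : {U : Set} (S P M : Subset U) →
  Degenerate M S → Conclusion S P M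
degenerate-MS⇒conclusion S P M (inj₁ (inj₁ h)) = inj₁ h
degenerate-MS⇒conclusion S P M (inj₁ (inj₂ h)) = inj₂ (inj₁ h)
degenerate-MS⇒conclusion S P M (inj₂ (inj₁ (inj₁ h))) =
  inj₂ (inj₂ (inj₂ (inj₂ (inj₁ h))))
degenerate-MS⇒conclusion S P M (inj₂ (inj₁ (inj₂ h))) =
  inj₂ (inj₂ (inj₂ (inj₂ (inj₂ (inj₁ h)))))
degenerate-MS⇒conclusion S P M (inj₂ (inj₂ (inj₁ h))) =
  inj₂ (inj₂ (inj₂ (inj₂ (inj₂ (inj₂ (inj₂ (inj₂ (inj₁ h))))))))
degenerate-MS⇒conclusion S P M (inj₂ (inj₂ (inj₂ h))) =
  inj₂ (inj₂ (inj₂ (inj₂ (inj₂ (inj₂ (inj₂ (inj₂ (inj₂ h))))))))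

distinct-true-PCPs⇒conclusion : {U : Set} (S P M : Subset U) (c d : PCP) →
  Distinct c d →
  PTrue S P M c → STrue S P M c → PTrue S P M d → STrue S P M d →
  Conclusion S P M
distinct-true-PCPs⇒conclusion S P M c d distinct pc sc pd sd
  with true-premises-coincide-or-degenerate M P (m c) (p c) (m d) (p d) pc pd
     | true-premises-coincide-or-degenerate M S
         (sMflag c) (s c) (sMflag d) (s d) sc sd
... | inj₂ degMP   | _           = degenerate-MP⇒conclusion S P M degMP
... | inj₁ _       | inj₂ degMS  = degenerate-MS⇒conclusion S P M degMS
... | inj₁ sameP   | inj₁ sameS  = ⊥-elim (distinct (sameP , sameS))

mainTheorem7 : {U : Set} (S P M : Subset U) (c d : PCP) →
    Distinct c d →
    PTrue S P M c → STrue S P M c → PTrue S P M d → STrue S P M d →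
    ¬ ¬ (M ≐ ∅ ⊎ (M ′) ≐ ∅ ⊎ P ≐ ∅ ⊎ (P ′) ≐ ∅ ⊎ S ≐ ∅ ⊎ (S ′) ≐ ∅
         ⊎ P ≐ M ⊎ P ≐ (M ′) ⊎ S ≐ M ⊎ S ≐ (M ′))
mainTheorem7 S P M c d distinct pc sc pd sd refute =
  refute (distinct-true-PCPs⇒conclusion S P M c d distinct pc sc pd sd)
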